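{- Let $G$ be a finitely generated nilpotent group, let $K\ge1$, and let $A$ be a $K$-approximate subgroup of $G$ such that $G=A\cdot Z(G)$. Then there is a central series $G\supseteq[G,G]=\Gamma_1\supseteq\Gamma_2\supseteq\cdots\supseteq\Gamma_r\supseteq\Gamma_{r+1}=\{1\}$ for $G$ such that $\Gamma_i\subseteq A^4\Gamma_{i+1}$ for each $i=1,\dots,r$.
   Context: $Z(G)$ is the centre of $G$, $[G,G]$ the commutator subgroup, $A^4$ the set of products of four elements of $A$. A central series means each $\Gamma_i$ is a normal subgroup of $G$ with $[G,\Gamma_i]\subseteq\Gamma_{i+1}$. A finite set $A\subseteq G$ is a $K$-approximate subgroup of $G$ if $A$ is symmetric, contains the identity, and there is $X\subseteq G$ with $|X|\le K$ and $A^2\subseteq XA$. -}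

module Defs where

open import Level using (Level; _⊔_)
open import Data.Nat using (ℕ; zero; suc; _≤_)
open import Data.List using (List; length)
open import Data.List.Relation.Unary.Any using (Any)
open import Data.Product using (Σ; ∃; _×_; _,_)
open import Algebra.Bundles using (Group)
open import Relation.Unary using (Pred)

module GroupDefs {c ℓ : Level} (G : Group c ℓ) where
  open Group G

  L : Level
  L = c ⊔ ℓ

  Respects≈ : Pred Carrier L → Set L
  Respects≈ S = ∀ {x y} → x ≈ y → S x → S y

  _⊆′_ : Pred Carrier L → Pred Carrier L → Set L
  S ⊆′ T = ∀ {x} → S x → T x

  _∈ₗ_ : Carrier → List Carrier → Set L
  x ∈ₗ A = Any (x ≈_) A

  Whole : Pred Carrier L
  Whole _ = Level.Lift L Data.Unit.⊤
    where import Data.Unit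

  Trivial : Pred Carrier L
  Trivial x = Level.Lift c (x ≈ ε)

  ⁅_,_⁆ : Carrier → Carrier → Carrier
  ⁅ x , y ⁆ = ((x ⁻¹ ∙ y ⁻¹) ∙ x) ∙ y

  data ⟨_⟩ (S : Pred Carrier L) : Pred Carrier L where
    gen  : ∀ {x} → S x → ⟨ S ⟩ x
    one  : ⟨ S ⟩ ε
    mul  : ∀ {x y} → ⟨ S ⟩ x → ⟨ S ⟩ y → ⟨ S ⟩ (x ∙ y)
    inv  : ∀ {x} → ⟨ S ⟩ x → ⟨ S ⟩ (x ⁻¹)
    resp : ∀ {x y} → x ≈ y → ⟨ S ⟩ x → ⟨ S ⟩ y

  CommSet : Pred Carrier L → Pred Carrier L → Pred Carrier L
  CommSet S T x = Σ Carrier λ s → Σ Carrier λ t → S s × T t × (x ≈ ⁅ s , t ⁆)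

  ⁅_,_⁆ₛ : Pred Carrier L → Pred Carrier L → Pred Carrier L
  ⁅ S , T ⁆ₛ = ⟨ CommSet S T ⟩

  record IsNormalSubgroup (H : Pred Carrier L) : Set L where
    field
      resp≈  : Respects≈ H
      has-ε  : H ε
      ∙-cl   : ∀ {x y} → H x → H y → H (x ∙ y)
      ⁻¹-cl  : ∀ {x} → H x → H (x ⁻¹)
      conj-cl : ∀ g {h} → H h → H ((g ⁻¹ ∙ h) ∙ g)

  γ : ℕ → Pred Carrier L
  γ zero = Whole
  γ (suc n) = ⁅ Whole , γ n ⁆ₛ

  IsNilpotent : Set L
  IsNilpotent = Σ ℕ λ n → γ n ⊆′ Trivial

  IsFinitelyGenerated : Set L
  IsFinitelyGenerated = Σ (List Carrier) λ gens → ∀ x → ⟨ (λ y → y ∈ₗ gens) ⟩ x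

  Centre : Pred Carrier L
  Centre z = ∀ g → z ∙ g ≈ g ∙ z

  record IsApproxSubgroup (K : ℕ) (A : List Carrier) : Set L where
    field
      symmetric : ∀ {a} → a ∈ₗ A → (a ⁻¹) ∈ₗ A
      has-ε     : ε ∈ₗ A
      cover     : Σ (List Carrier) λ X → length X ≤ K ×
                    (∀ {a b} → a ∈ₗ A → b ∈ₗ A →
                      Σ Carrier λ x → Σ Carrier λ a′ →
                        x ∈ₗ X × a′ ∈ₗ A × ((a ∙ b) ≈ (x ∙ a′)))

  GeneratedByCentre : List Carrier → Set L
  GeneratedByCentre A = ∀ g → Σ Carrier λ a → Σ Carrier λ z →
                          a ∈ₗ A × Centre z × (g ≈ a ∙ z)

  _∈A⁴_ : Carrier → List Carrier × Pred Carrier L → Set L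
  x ∈A⁴ (A , H) = Σ Carrier λ a₁ → Σ Carrier λ a₂ → Σ Carrier λ a₃ →
    Σ Carrier λ a₄ → Σ Carrier λ h →
    a₁ ∈ₗ A × a₂ ∈ₗ A × a₃ ∈ₗ A × a₄ ∈ₗ A × H h ×
    (x ≈ (((a₁ ∙ a₂) ∙ a₃) ∙ a₄) ∙ h)

  -- Γ₁ ⊇ … ⊇ Γ_{r+1} (indices 1..r+1 of Γ : ℕ → Pred) is a central series
  -- from [G,G] down to {1}, with Γ_i ⊆ A⁴ Γ_{i+1} for i = 1..r
  record GoodCentralSeries (A : List Carrier) (r : ℕ) (Γ : ℕ → Pred Carrier L) : Set L where
    field
      normal    : ∀ i → 1 ≤ i → i ≤ suc r → IsNormalSubgroup (Γ i)
      first⊆    : Γ 1 ⊆′ ⁅ Whole , Whole ⁆ₛ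
      first⊇    : ⁅ Whole , Whole ⁆ₛ ⊆′ Γ 1
      last⊆     : Γ (suc r) ⊆′ Trivial
      last⊇     : Trivial ⊆′ Γ (suc r)
      decreasing : ∀ i → 1 ≤ i → i ≤ r → Γ (suc i) ⊆′ Γ i
      central   : ∀ i → 1 ≤ i → i ≤ r → ⁅ Whole , Γ i ⁆ₛ ⊆′ Γ (suc i)
      approx    : ∀ i → 1 ≤ i → i ≤ r → ∀ {x} → Γ i x → x ∈A⁴ (A , Γ (suc i))

module Submission where

-- Let γ₀ = G, γₖ₊₁ = [G, γₖ] be the lower central series and let
-- a₁, …, aₘ be the elements of A.  Between γₖ₊₁ and γₖ₊₂ we insert the normal
-- subgroups
--     Δ(k, aⱼ…aₘ) = ⟨ [a, h] : a ∈ {aⱼ,…,aₘ}, h ∈ γₖ ⟩ · γₖ₊₂ ,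
-- so Δ(k, a₁…aₘ) = γₖ₊₁ (because G = A·Z(G) and [az, h] = [a, h] for central z)
-- and Δ(k, ∅) = γₖ₊₂.  Every term lies in γₖ₊₁, so [G, Δ] ⊆ γₖ₊₂: the chain is
-- central.  Each element of Δ(k, a ∷ Ls) has the shape [a, h]·n with h ∈ γₖ and
-- n ∈ Δ(k, Ls); writing h = bz with b ∈ A, z central gives [a, h] = a⁻¹b⁻¹ab,
-- whence Δ(k, a ∷ Ls) ⊆ A⁴ Δ(k, Ls).  Walking through k = 0, 1, …, n (with γₙ
-- trivial) and all suffixes of A yields the series of the theorem.

open import Defs
open import Level using (Level; _⊔_)
open import Data.Nat using (ℕ; _≤_)
open import Data.List using (List)
open import Data.Product using (Σ)
open import Algebra.Bundles using (Group)
open import Relation.Unary using (Pred)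

open import Level using (lift)
open import Data.Nat using (zero; suc; _+_)
open import Data.Nat.Properties using (+-suc)
open import Data.Fin using (Fin; zero; suc) renaming (_≟_ to _≟F_)
open import Data.Bool using (Bool; true; false; not)
open import Data.List using ([]; _∷_; foldr; length)
open import Data.List.Relation.Unary.Any using (here; there)
open import Data.Vec using (Vec; lookup; []; _∷_)
open import Data.Product using (_×_; _,_; proj₁; proj₂)
open import Data.Sum using (_⊎_; inj₁; inj₂)
open import Data.Unit using (tt)
open import Relation.Nullary using (yes; no)
open import Relation.Binary.PropositionalEquality as P using (_≡_)

-- Group identities by free reduction: an expression evaluates to the value of
-- its freely reduced word, so two expressions with the same reduced word are
-- equal in every group.
module FreeReduction {c ℓ : Level} (G : Group c ℓ) where
  open Group G
  open import Algebra.Properties.Group G using (ε⁻¹≈ε; ⁻¹-involutive; ⁻¹-anti-homo-∙)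
  open import Relation.Binary.Reasoning.Setoid setoid

  infixl 7 _⊗_
  infix 8 _⁻¹ᵉ

  data Expr (n : ℕ) : Set where
    var  : Fin n → Expr n
    𝟙    : Expr n
    _⊗_  : Expr n → Expr n → Expr n
    _⁻¹ᵉ : Expr n → Expr n

  ⟦_⟧ : ∀ {n} → Expr n → Vec Carrier n → Carrier
  ⟦ var i ⟧ ρ = lookup ρ i
  ⟦ 𝟙 ⟧ ρ = ε
  ⟦ e ⊗ f ⟧ ρ = ⟦ e ⟧ ρ ∙ ⟦ f ⟧ ρ
  ⟦ e ⁻¹ᵉ ⟧ ρ = ⟦ e ⟧ ρ ⁻¹

  Letter : ℕ → Set
  Letter n = Fin n × Bool

  ⟦_⟧ₗ : ∀ {n} → Letter n → Vec Carrier n → Carrier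
  ⟦ i , true ⟧ₗ ρ = lookup ρ i
  ⟦ i , false ⟧ₗ ρ = lookup ρ i ⁻¹

  ⟦_⟧w : ∀ {n} → List (Letter n) → Vec Carrier n → Carrier
  ⟦ [] ⟧w ρ = ε
  ⟦ l ∷ w ⟧w ρ = ⟦ l ⟧ₗ ρ ∙ ⟦ w ⟧w ρ

  -- prepend the letter (i , b) to a word starting with (i , b′) ∷ w
  prependSame : ∀ {n} → Fin n → Bool → Bool → List (Letter n) → List (Letter n)
  prependSame i true false w = w
  prependSame i false true w = w
  prependSame i b b′ w = (i , b) ∷ (i , b′) ∷ w

  _◃_ : ∀ {n} → Letter n → List (Letter n) → List (Letter n)
  l ◃ [] = l ∷ []
  (i , b) ◃ ((j , b′) ∷ w) with i ≟F j
  ... | no _ = (i , b) ∷ (j , b′) ∷ w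
  ... | yes P.refl = prependSame i b b′ w

  ◃-sound : ∀ {n} (l : Letter n) w ρ → ⟦ l ◃ w ⟧w ρ ≈ ⟦ l ⟧ₗ ρ ∙ ⟦ w ⟧w ρ
  ◃-sound l [] ρ = refl
  ◃-sound (i , b) ((j , b′) ∷ w) ρ with i ≟F j
  ... | no _ = refl
  ◃-sound (i , true) ((j , false) ∷ w) ρ | yes P.refl = sym (begin
      lookup ρ i ∙ (lookup ρ i ⁻¹ ∙ ⟦ w ⟧w ρ) ≈⟨ sym (assoc _ _ _) ⟩
      (lookup ρ i ∙ lookup ρ i ⁻¹) ∙ ⟦ w ⟧w ρ ≈⟨ ∙-congʳ (inverseʳ _) ⟩
      ε ∙ ⟦ w ⟧w ρ                            ≈⟨ identityˡ _ ⟩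
      ⟦ w ⟧w ρ                                ∎)
  ◃-sound (i , false) ((j , true) ∷ w) ρ | yes P.refl = sym (begin
      lookup ρ i ⁻¹ ∙ (lookup ρ i ∙ ⟦ w ⟧w ρ) ≈⟨ sym (assoc _ _ _) ⟩
      (lookup ρ i ⁻¹ ∙ lookup ρ i) ∙ ⟦ w ⟧w ρ ≈⟨ ∙-congʳ (inverseˡ _) ⟩
      ε ∙ ⟦ w ⟧w ρ                            ≈⟨ identityˡ _ ⟩
      ⟦ w ⟧w ρ                                ∎)
  ◃-sound (i , true) ((j , true) ∷ w) ρ | yes P.refl = refl
  ◃-sound (i , false) ((j , false) ∷ w) ρ | yes P.refl = refl

  _⋯_ : ∀ {n} → List (Letter n) → List (Letter n) → List (Letter n)
  v ⋯ w = foldr _◃_ w v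

  ⋯-sound : ∀ {n} (v w : List (Letter n)) ρ → ⟦ v ⋯ w ⟧w ρ ≈ ⟦ v ⟧w ρ ∙ ⟦ w ⟧w ρ
  ⋯-sound [] w ρ = sym (identityˡ _)
  ⋯-sound (l ∷ v) w ρ = begin
    ⟦ l ◃ (v ⋯ w) ⟧w ρ              ≈⟨ ◃-sound l (v ⋯ w) ρ ⟩
    ⟦ l ⟧ₗ ρ ∙ ⟦ v ⋯ w ⟧w ρ         ≈⟨ ∙-congˡ (⋯-sound v w ρ) ⟩
    ⟦ l ⟧ₗ ρ ∙ (⟦ v ⟧w ρ ∙ ⟦ w ⟧w ρ) ≈⟨ sym (assoc _ _ _) ⟩
    (⟦ l ⟧ₗ ρ ∙ ⟦ v ⟧w ρ) ∙ ⟦ w ⟧w ρ ∎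

  flipLetter : ∀ {n} → Letter n → Letter n
  flipLetter (i , b) = (i , not b)

  flipLetter-sound : ∀ {n} (l : Letter n) ρ → ⟦ flipLetter l ⟧ₗ ρ ≈ ⟦ l ⟧ₗ ρ ⁻¹
  flipLetter-sound (i , true) ρ = refl
  flipLetter-sound (i , false) ρ = sym (⁻¹-involutive _)

  invWord : ∀ {n} → List (Letter n) → List (Letter n)
  invWord [] = []
  invWord (l ∷ w) = invWord w ⋯ (flipLetter l ∷ [])

  invWord-sound : ∀ {n} (w : List (Letter n)) ρ → ⟦ invWord w ⟧w ρ ≈ ⟦ w ⟧w ρ ⁻¹
  invWord-sound [] ρ = sym ε⁻¹≈ε
  invWord-sound (l ∷ w) ρ = begin
    ⟦ invWord w ⋯ (flipLetter l ∷ []) ⟧w ρ   ≈⟨ ⋯-sound (invWord w) _ ρ ⟩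
    ⟦ invWord w ⟧w ρ ∙ (⟦ flipLetter l ⟧ₗ ρ ∙ ε) ≈⟨ ∙-cong (invWord-sound w ρ) (identityʳ _) ⟩
    ⟦ w ⟧w ρ ⁻¹ ∙ ⟦ flipLetter l ⟧ₗ ρ        ≈⟨ ∙-congˡ (flipLetter-sound l ρ) ⟩
    ⟦ w ⟧w ρ ⁻¹ ∙ ⟦ l ⟧ₗ ρ ⁻¹                ≈⟨ sym (⁻¹-anti-homo-∙ _ _) ⟩
    (⟦ l ⟧ₗ ρ ∙ ⟦ w ⟧w ρ) ⁻¹                 ∎

  reduce : ∀ {n} → Expr n → List (Letter n)
  reduce (var i) = (i , true) ∷ []
  reduce 𝟙 = []
  reduce (e ⊗ f) = reduce e ⋯ reduce f
  reduce (e ⁻¹ᵉ) = invWord (reduce e)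

  reduce-sound : ∀ {n} (e : Expr n) ρ → ⟦ reduce e ⟧w ρ ≈ ⟦ e ⟧ ρ
  reduce-sound (var i) ρ = identityʳ _
  reduce-sound 𝟙 ρ = refl
  reduce-sound (e ⊗ f) ρ =
    trans (⋯-sound (reduce e) (reduce f) ρ) (∙-cong (reduce-sound e ρ) (reduce-sound f ρ))
  reduce-sound (e ⁻¹ᵉ) ρ = trans (invWord-sound (reduce e) ρ) (⁻¹-cong (reduce-sound e ρ))

  solve : ∀ {n} (e f : Expr n) → reduce e ≡ reduce f → ∀ ρ → ⟦ e ⟧ ρ ≈ ⟦ f ⟧ ρ
  solve e f same ρ = begin
    ⟦ e ⟧ ρ          ≈⟨ reduce-sound e ρ ⟨
    ⟦ reduce e ⟧w ρ  ≡⟨ P.cong (λ w → ⟦ w ⟧w ρ) same ⟩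
    ⟦ reduce f ⟧w ρ  ≈⟨ reduce-sound f ρ ⟩
    ⟦ f ⟧ ρ          ∎

  [_,_]ᵉ : ∀ {n} → Expr n → Expr n → Expr n
  [ e , f ]ᵉ = ((e ⁻¹ᵉ ⊗ f ⁻¹ᵉ) ⊗ e) ⊗ f

  conjᵉ : ∀ {n} → Expr n → Expr n → Expr n
  conjᵉ g e = (g ⁻¹ᵉ ⊗ e) ⊗ g

  x₀ : ∀ {n} → Expr (suc n)
  x₀ = var zero
  x₁ : ∀ {n} → Expr (suc (suc n))
  x₁ = var (suc zero)
  x₂ : ∀ {n} → Expr (suc (suc (suc n)))
  x₂ = var (suc (suc zero))
  x₃ : ∀ {n} → Expr (suc (suc (suc (suc n))))
  x₃ = var (suc (suc (suc zero)))
  x₄ : ∀ {n} → Expr (suc (suc (suc (suc (suc n)))))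
  x₄ = var (suc (suc (suc (suc zero))))

module GroupTheory {c ℓ : Level} (G : Group c ℓ) where
  open Group G
  open GroupDefs G
  open FreeReduction G using (Expr; solve; 𝟙; _⊗_; _⁻¹ᵉ; [_,_]ᵉ; conjᵉ; x₀; x₁; x₂; x₃; x₄)

  record IsSubgroup (H : Pred Carrier L) : Set L where
    field
      resp≈ : Respects≈ H
      has-ε : H ε
      ∙-cl  : ∀ {x y} → H x → H y → H (x ∙ y)
      ⁻¹-cl : ∀ {x} → H x → H (x ⁻¹)

  normal⇒subgroup : ∀ {N} → IsNormalSubgroup N → IsSubgroup N
  normal⇒subgroup N◁G = record { resp≈ = resp≈ ; has-ε = has-ε ; ∙-cl = ∙-cl ; ⁻¹-cl = ⁻¹-cl }
    where open IsNormalSubgroup N◁G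

  ⟨⟩-isSubgroup : ∀ S → IsSubgroup ⟨ S ⟩
  ⟨⟩-isSubgroup S = record { resp≈ = resp ; has-ε = one ; ∙-cl = mul ; ⁻¹-cl = inv }

  ⟨⟩-least : ∀ {S H} → IsSubgroup H → S ⊆′ H → ⟨ S ⟩ ⊆′ H
  ⟨⟩-least H≤G S⊆H (gen s) = S⊆H s
  ⟨⟩-least H≤G S⊆H one = IsSubgroup.has-ε H≤G
  ⟨⟩-least H≤G S⊆H (mul p q) = IsSubgroup.∙-cl H≤G (⟨⟩-least H≤G S⊆H p) (⟨⟩-least H≤G S⊆H q)
  ⟨⟩-least H≤G S⊆H (inv p) = IsSubgroup.⁻¹-cl H≤G (⟨⟩-least H≤G S⊆H p)
  ⟨⟩-least H≤G S⊆H (resp x≈y p) = IsSubgroup.resp≈ H≤G x≈y (⟨⟩-least H≤G S⊆H p)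

  Trivial⊆ : ∀ {H} → IsSubgroup H → Trivial ⊆′ H
  Trivial⊆ H≤G (lift x≈ε) = IsSubgroup.resp≈ H≤G (sym x≈ε) (IsSubgroup.has-ε H≤G)

  Whole-normal : IsNormalSubgroup Whole
  Whole-normal = record
    { resp≈ = λ _ _ → lift tt ; has-ε = lift tt ; ∙-cl = λ _ _ → lift tt
    ; ⁻¹-cl = λ _ → lift tt ; conj-cl = λ _ _ → lift tt }

  conj : Carrier → Carrier → Carrier
  conj g h = (g ⁻¹ ∙ h) ∙ g

  -- conjugation by g is an automorphism, so preimages of subgroups are subgroups
  conj-preimage : ∀ {H} g → IsSubgroup H → IsSubgroup (λ x → H (conj g x))
  conj-preimage g H≤G = record
    { resp≈ = λ x≈y → resp≈ (∙-congʳ (∙-congˡ x≈y))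
    ; has-ε = resp≈ (sym (solve (conjᵉ x₀ 𝟙) 𝟙 P.refl (g ∷ []))) has-ε
    ; ∙-cl  = λ {x} {y} p q → resp≈
        (sym (solve (conjᵉ x₀ (x₁ ⊗ x₂)) (conjᵉ x₀ x₁ ⊗ conjᵉ x₀ x₂) P.refl (g ∷ x ∷ y ∷ [])))
        (∙-cl p q)
    ; ⁻¹-cl = λ {x} p → resp≈
        (sym (solve (conjᵉ x₀ (x₁ ⁻¹ᵉ)) (conjᵉ x₀ x₁ ⁻¹ᵉ) P.refl (g ∷ x ∷ []))) (⁻¹-cl p) }
    where open IsSubgroup H≤G

  ⟨⟩-normal : ∀ {S} → (∀ g {s} → S s → ⟨ S ⟩ (conj g s)) → IsNormalSubgroup ⟨ S ⟩
  ⟨⟩-normal {S} conj-gen = record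
    { resp≈ = resp ; has-ε = one ; ∙-cl = mul ; ⁻¹-cl = inv
    ; conj-cl = λ g → ⟨⟩-least (conj-preimage g (⟨⟩-isSubgroup S)) (conj-gen g) }

  conj-via-comm : ∀ g s → conj g s ≈ s ∙ ⁅ g , s ⁆ ⁻¹
  conj-via-comm g s = solve (conjᵉ x₀ x₁) (x₁ ⊗ [ x₀ , x₁ ]ᵉ ⁻¹ᵉ) P.refl (g ∷ s ∷ [])

  comm-via-conj : ∀ t u → ⁅ t , u ⁆ ≈ conj t (u ⁻¹) ∙ u
  comm-via-conj t u = solve [ x₀ , x₁ ]ᵉ (conjᵉ x₀ (x₁ ⁻¹ᵉ) ⊗ x₁) P.refl (t ∷ u ∷ [])

  conj-comm : ∀ g t u → conj g ⁅ t , u ⁆ ≈ ⁅ t ∙ g , u ⁆ ∙ ⁅ g , u ⁆ ⁻¹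
  conj-comm g t u =
    solve (conjᵉ x₀ [ x₁ , x₂ ]ᵉ) ([ x₁ ⊗ x₀ , x₂ ]ᵉ ⊗ [ x₀ , x₂ ]ᵉ ⁻¹ᵉ) P.refl (g ∷ t ∷ u ∷ [])

  comm-swap : ∀ x y → ⁅ x , y ⁆ ≈ ⁅ y , x ⁆ ⁻¹
  comm-swap x y = solve [ x₀ , x₁ ]ᵉ ([ x₁ , x₀ ]ᵉ ⁻¹ᵉ) P.refl (x ∷ y ∷ [])

  comm-ε : ∀ a → ⁅ a , ε ⁆ ≈ ε
  comm-ε a = solve [ x₀ , 𝟙 ]ᵉ 𝟙 P.refl (a ∷ [])

  comm-congˡ : ∀ {x y} h → x ≈ y → ⁅ x , h ⁆ ≈ ⁅ y , h ⁆
  comm-congˡ h x≈y = ∙-congʳ (∙-cong (∙-congʳ (⁻¹-cong x≈y)) x≈y)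

  comm-congʳ : ∀ a {x y} → x ≈ y → ⁅ a , x ⁆ ≈ ⁅ a , y ⁆
  comm-congʳ a x≈y = ∙-cong (∙-congʳ (∙-congˡ (⁻¹-cong x≈y))) x≈y

  comm-centralʳ : ∀ a b z → Centre z → ⁅ a , b ∙ z ⁆ ≈ ⁅ a , b ⁆
  comm-centralʳ a b z z-central = begin
    ⁅ a , b ∙ z ⁆
      ≈⟨ solve [ x₀ , x₁ ⊗ x₂ ]ᵉ (x₀ ⁻¹ᵉ ⊗ (x₂ ⁻¹ᵉ ⊗ (W ⊗ x₂))) P.refl ρ ⟩
    a ⁻¹ ∙ (z ⁻¹ ∙ (w ∙ z))
      ≈⟨ ∙-congˡ (∙-congˡ (sym (z-central w))) ⟩
    a ⁻¹ ∙ (z ⁻¹ ∙ (z ∙ w))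
      ≈⟨ solve (x₀ ⁻¹ᵉ ⊗ (x₂ ⁻¹ᵉ ⊗ (x₂ ⊗ W))) [ x₀ , x₁ ]ᵉ P.refl ρ ⟩
    ⁅ a , b ⁆
      ∎
    where
    open import Relation.Binary.Reasoning.Setoid setoid
    ρ : Vec Carrier 3
    ρ = a ∷ b ∷ z ∷ []
    W : Expr 3
    W = (x₁ ⁻¹ᵉ ⊗ x₀) ⊗ x₁
    w : Carrier
    w = (b ⁻¹ ∙ a) ∙ b

  comm-centralˡ : ∀ a z h → Centre z → ⁅ a ∙ z , h ⁆ ≈ ⁅ a , h ⁆
  comm-centralˡ a z h z-central =
    trans (comm-swap (a ∙ z) h) (trans (⁻¹-cong (comm-centralʳ h a z z-central)) (sym (comm-swap a h)))

  ⁅G,⁆-mono : ∀ {H H′} → H ⊆′ H′ → ⁅ Whole , H ⁆ₛ ⊆′ ⁅ Whole , H′ ⁆ₛ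
  ⁅G,⁆-mono H⊆H′ = ⟨⟩-least (⟨⟩-isSubgroup _)
    λ { (t , u , _ , Hu , x≈) → gen (t , u , lift tt , H⊆H′ Hu , x≈) }

  -- [G, H] is normal for any subset H, by the Hall identity
  ⁅G,⁆-normal : ∀ H → IsNormalSubgroup ⁅ Whole , H ⁆ₛ
  ⁅G,⁆-normal H = ⟨⟩-normal conj-gen
    where
    conj-gen : ∀ g {s} → CommSet Whole H s → ⁅ Whole , H ⁆ₛ (conj g s)
    conj-gen g (t , u , _ , Hu , s≈) =
      resp (sym (trans (∙-congʳ (∙-congˡ s≈)) (conj-comm g t u)))
           (mul (gen (t ∙ g , u , lift tt , Hu , refl)) (inv (gen (g , u , lift tt , Hu , refl))))

  -- [G, N] ⊆ N for a normal subgroup N, since [t, u] = t⁻¹u⁻¹t · u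
  ⁅G,⁆-⊆ : ∀ {N} → IsNormalSubgroup N → ⁅ Whole , N ⁆ₛ ⊆′ N
  ⁅G,⁆-⊆ N◁G = ⟨⟩-least (normal⇒subgroup N◁G) λ { (t , u , _ , Nu , s≈) →
    resp≈ (sym (trans s≈ (comm-via-conj t u))) (∙-cl (conj-cl t (⁻¹-cl Nu)) Nu) }
    where open IsNormalSubgroup N◁G

  γ-normal : ∀ k → IsNormalSubgroup (γ k)
  γ-normal zero = Whole-normal
  γ-normal (suc k) = ⁅G,⁆-normal (γ k)

  γ-subgroup : ∀ k → IsSubgroup (γ k)
  γ-subgroup k = normal⇒subgroup (γ-normal k)

  γ-decreasing : ∀ k → γ (suc k) ⊆′ γ k
  γ-decreasing k = ⁅G,⁆-⊆ (γ-normal k)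

  γ-comm : ∀ k g {h} → γ k h → γ (suc k) ⁅ g , h ⁆
  γ-comm k g {h} γh = gen (g , h , lift tt , γh , refl)

  -- The refinement of γₖ₊₁ ⊇ γₖ₊₂ along a list Ls of elements:
  -- Δ k Ls = ⟨ [a, h] : a ∈ Ls, h ∈ γₖ ⟩ · γₖ₊₂.
  ΔGen : ℕ → List Carrier → Pred Carrier L
  ΔGen k Ls x = (Σ Carrier λ a → Σ Carrier λ h → a ∈ₗ Ls × γ k h × (x ≈ ⁅ a , h ⁆))
              ⊎ γ (suc (suc k)) x

  Δ : ℕ → List Carrier → Pred Carrier L
  Δ k Ls = ⟨ ΔGen k Ls ⟩

  γ⊆Δ : ∀ k Ls → γ (suc (suc k)) ⊆′ Δ k Ls
  γ⊆Δ k Ls y = gen (inj₂ y)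

  Δ⊆γ : ∀ k Ls → Δ k Ls ⊆′ γ (suc k)
  Δ⊆γ k Ls = ⟨⟩-least (γ-subgroup (suc k)) λ
    { (inj₁ (a , h , _ , γh , x≈)) → resp (sym x≈) (γ-comm k a γh)
    ; (inj₂ y) → γ-decreasing (suc k) y }

  Δ[]⊆γ : ∀ k → Δ k [] ⊆′ γ (suc (suc k))
  Δ[]⊆γ k = ⟨⟩-least (γ-subgroup (suc (suc k))) λ { (inj₁ (_ , _ , () , _)) ; (inj₂ y) → y }

  Δ-cons : ∀ k a Ls → Δ k Ls ⊆′ Δ k (a ∷ Ls)
  Δ-cons k a Ls = ⟨⟩-least (⟨⟩-isSubgroup _) λ
    { (inj₁ (b , h , b∈ , γh , x≈)) → gen (inj₁ (b , h , there b∈ , γh , x≈))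
    ; (inj₂ y) → gen (inj₂ y) }

  -- a generator s is conjugated to s[g,s]⁻¹, and [g,s] ∈ γₖ₊₂ as s ∈ γₖ₊₁
  Δ-normal : ∀ k Ls → IsNormalSubgroup (Δ k Ls)
  Δ-normal k Ls = ⟨⟩-normal λ g {s} s-gen →
    resp (sym (conj-via-comm g s))
         (mul (gen s-gen) (inv (γ⊆Δ k Ls (γ-comm (suc k) g (Δ⊆γ k Ls (gen s-gen))))))

  CommTimesΔ : ℕ → Carrier → List Carrier → Pred Carrier L
  CommTimesΔ k a Ls x =
    Σ Carrier λ h → Σ Carrier λ n → γ k h × Δ k Ls n × (x ≈ ⁅ a , h ⁆ ∙ n)

  -- they form a subgroup: the error terms produced by multiplying and
  -- inverting are commutators with elements of γₖ₊₁ or conjugates of Δ k Ls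
  CommTimesΔ-subgroup : ∀ k a Ls → IsSubgroup (CommTimesΔ k a Ls)
  CommTimesΔ-subgroup k a Ls = record
    { resp≈ = λ { x≈y (h , n , γh , Δn , x≈) → h , n , γh , Δn , trans (sym x≈y) x≈ }
    ; has-ε = ε , ε , has-ε , one , solve 𝟙 ([ x₀ , 𝟙 ]ᵉ ⊗ 𝟙) P.refl (a ∷ [])
    ; ∙-cl  = product-cl
    ; ⁻¹-cl = inverse-cl }
    where
    open IsSubgroup (γ-subgroup k)
    open IsNormalSubgroup (Δ-normal k Ls) using (conj-cl)

    product-cl : ∀ {x y} → CommTimesΔ k a Ls x → CommTimesΔ k a Ls y → CommTimesΔ k a Ls (x ∙ y)
    product-cl (h , n , γh , Δn , x≈) (h′ , n′ , γh′ , Δn′ , y≈) =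
      h ∙ h′ , _ , ∙-cl γh γh′ , error∈Δ , trans (∙-cong x≈ y≈) regroup
      where
      c₁ c₂ : Carrier
      c₁ = ⁅ a , h ⁆
      c₂ = ⁅ a , h′ ⁆
      regroup : (c₁ ∙ n) ∙ (c₂ ∙ n′) ≈
                ⁅ a , h ∙ h′ ⁆ ∙ ((⁅ h′ , c₁ ⁆ ∙ ⁅ c₂ , c₁ ⁆ ⁻¹) ∙ (conj c₂ n ∙ n′))
      regroup = solve (([ x₀ , x₁ ]ᵉ ⊗ x₃) ⊗ ([ x₀ , x₂ ]ᵉ ⊗ x₄))
        ([ x₀ , x₁ ⊗ x₂ ]ᵉ ⊗ (([ x₂ , [ x₀ , x₁ ]ᵉ ]ᵉ ⊗ [ [ x₀ , x₂ ]ᵉ , [ x₀ , x₁ ]ᵉ ]ᵉ ⁻¹ᵉ)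
                              ⊗ (conjᵉ [ x₀ , x₂ ]ᵉ x₃ ⊗ x₄)))
        P.refl (a ∷ h ∷ h′ ∷ n ∷ n′ ∷ [])
      γc₁ : γ (suc k) c₁
      γc₁ = γ-comm k a γh
      error∈Δ : Δ k Ls ((⁅ h′ , c₁ ⁆ ∙ ⁅ c₂ , c₁ ⁆ ⁻¹) ∙ (conj c₂ n ∙ n′))
      error∈Δ = mul (mul (γ⊆Δ k Ls (γ-comm (suc k) h′ γc₁))
                         (inv (γ⊆Δ k Ls (γ-comm (suc k) c₂ γc₁))))
                    (mul (conj-cl c₂ Δn) Δn′)

    inverse-cl : ∀ {x} → CommTimesΔ k a Ls x → CommTimesΔ k a Ls (x ⁻¹)
    inverse-cl (h , n , γh , Δn , x≈) =
      h ⁻¹ , _ , ⁻¹-cl γh , error∈Δ , trans (⁻¹-cong x≈) regroup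
      where
      c₁ d : Carrier
      c₁ = ⁅ a , h ⁆
      d = ⁅ a , h ⁻¹ ⁆
      regroup : (c₁ ∙ n) ⁻¹ ≈ d ∙ (⁅ h , d ⁆ ⁻¹ ∙ conj (c₁ ⁻¹) (n ⁻¹))
      regroup = solve (([ x₀ , x₁ ]ᵉ ⊗ x₂) ⁻¹ᵉ)
        ([ x₀ , x₁ ⁻¹ᵉ ]ᵉ ⊗ ([ x₁ , [ x₀ , x₁ ⁻¹ᵉ ]ᵉ ]ᵉ ⁻¹ᵉ
                              ⊗ conjᵉ ([ x₀ , x₁ ]ᵉ ⁻¹ᵉ) (x₂ ⁻¹ᵉ)))
        P.refl (a ∷ h ∷ n ∷ [])
      error∈Δ : Δ k Ls (⁅ h , d ⁆ ⁻¹ ∙ conj (c₁ ⁻¹) (n ⁻¹))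
      error∈Δ = mul (inv (γ⊆Δ k Ls (γ-comm (suc k) h (γ-comm k a (⁻¹-cl γh)))))
                    (conj-cl (c₁ ⁻¹) (inv Δn))

  Δ-cons-split : ∀ k a Ls → Δ k (a ∷ Ls) ⊆′ CommTimesΔ k a Ls
  Δ-cons-split k a Ls = ⟨⟩-least (CommTimesΔ-subgroup k a Ls) λ
    { (inj₁ (b , h , here b≈a , γh , x≈)) →
        h , ε , γh , one , trans x≈ (trans (comm-congˡ h b≈a) (sym (identityʳ _)))
    ; (inj₁ (b , h , there b∈ , γh , x≈)) → with-ε (gen (inj₁ (b , h , b∈ , γh , x≈)))
    ; (inj₂ y) → with-ε (gen (inj₂ y)) }
    where
    with-ε : Δ k Ls ⊆′ CommTimesΔ k a Ls
    with-ε {x} Δx = ε , x , IsSubgroup.has-ε (γ-subgroup k) , Δx ,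
                    sym (trans (∙-congʳ (comm-ε a)) (identityˡ x))

  -- The series for a list A: the state (k , Ls) stands for Δ k Ls, where Ls
  -- runs through the suffixes of A; after the empty suffix we pass to k + 1.
  module Series (A : List Carrier) where

    State : Set c
    State = ℕ × List Carrier

    ΔS : State → Pred Carrier L
    ΔS (k , Ls) = Δ k Ls

    next : State → State
    next (k , _ ∷ Ls) = (k , Ls)
    next (k , []) = (suc k , A)

    pos : ℕ → State
    pos zero = (0 , A)
    pos (suc i) = next (pos i)

    -- the terms decrease: drop a letter, or Δ (k+1) A ⊆ γₖ₊₂ ⊆ Δ k []
    next-⊆ : ∀ p → ΔS (next p) ⊆′ ΔS p
    next-⊆ (k , a ∷ Ls) = Δ-cons k a Ls
    next-⊆ (k , []) Δx = γ⊆Δ k [] (Δ⊆γ (suc k) A Δx)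

    -- [G, Δ k Ls] ⊆ γₖ₊₂, which lies in the next term (γₖ₊₃ if Ls = [])
    next-central : ∀ p → ⁅ Whole , ΔS p ⁆ₛ ⊆′ ΔS (next p)
    next-central (k , a ∷ Ls) x∈ = γ⊆Δ k Ls (⁅G,⁆-mono (Δ⊆γ k (a ∷ Ls)) x∈)
    next-central (k , []) x∈ = γ⊆Δ (suc k) A (⁅G,⁆-mono (Δ[]⊆γ k) x∈)

    walk : ∀ Ls i k → pos i ≡ (k , Ls) → pos (suc (length Ls + i)) ≡ (suc k , A)
    walk [] i k eq = P.cong next eq
    walk (x ∷ Ls) i k eq = P.subst (λ m → pos (suc m) ≡ (suc k , A)) (+-suc (length Ls) i)
                                   (walk Ls (suc i) k (P.cong next eq))

    reach : ∀ k → Σ ℕ λ r → pos r ≡ (k , A)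
    reach zero = 0 , P.refl
    reach (suc k) with reach k
    ... | r , eq = suc (length A + r) , walk A r k eq

    pos-⊆A : ∀ i {x} → x ∈ₗ proj₂ (pos i) → x ∈ₗ A
    pos-⊆A zero x∈ = x∈
    pos-⊆A (suc i) x∈ with pos i | pos-⊆A i
    ... | (k , a ∷ Ls) | ⊆A = ⊆A (there x∈)
    ... | (k , []) | _ = x∈

    module Approximation (A-symmetric : ∀ {a} → a ∈ₗ A → (a ⁻¹) ∈ₗ A) (ε∈A : ε ∈ₗ A)
                         (G=AZ : GeneratedByCentre A) where

      -- γₖ₊₁ = Δ k A: write g = az in a generator [g, h]; then [g, h] = [a, h]
      γ⊆ΔA : ∀ k → γ (suc k) ⊆′ Δ k A
      γ⊆ΔA k = ⟨⟩-least (⟨⟩-isSubgroup _) λ { (g , h , _ , γh , x≈) → from-generator g h γh x≈ }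
        where
        from-generator : ∀ {x} g h → γ k h → x ≈ ⁅ g , h ⁆ → Δ k A x
        from-generator g h γh x≈ with G=AZ g
        ... | a , z , a∈ , z-central , g≈az = gen (inj₁ (a , h , a∈ , γh ,
                trans x≈ (trans (comm-congˡ h g≈az) (comm-centralˡ a z h z-central))))

      -- x = [a, h]·n and h = bz give x = a⁻¹b⁻¹ab·n
      next-approx : ∀ p → (∀ {x} → x ∈ₗ proj₂ p → x ∈ₗ A) →
                    ∀ {x} → ΔS p x → x ∈A⁴ (A , ΔS (next p))
      next-approx (k , a ∷ Ls) ⊆A Δx with Δ-cons-split k a Ls Δx
      ... | h , n , _ , Δn , x≈ with G=AZ h
      ... | b , z , b∈ , z-central , h≈bz =
        a ⁻¹ , b ⁻¹ , a , b , n , A-symmetric a∈ , A-symmetric b∈ , a∈ , b∈ , Δn ,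
        trans x≈ (∙-congʳ (trans (comm-congʳ a h≈bz) (comm-centralʳ a b z z-central)))
        where
        a∈ : a ∈ₗ A
        a∈ = ⊆A (here refl)
      next-approx (k , []) _ {x} Δx =
        ε , ε , ε , ε , x , ε∈A , ε∈A , ε∈A , ε∈A , γ⊆ΔA (suc k) (Δ[]⊆γ k Δx) ,
        solve x₀ ((((𝟙 ⊗ 𝟙) ⊗ 𝟙) ⊗ 𝟙) ⊗ x₀) P.refl (x ∷ [])

-- The theorem: the series is Γ₀ = G, Γᵢ₊₁ = ΔS (pos i), stopped at the state
-- (n , A) with γₙ trivial, where Δ n A ⊆ γₙ₊₁ ⊆ γₙ is trivial.
lemma4p4 : ∀ {c ℓ} (G : Group c ℓ) → let open GroupDefs G in
    IsFinitelyGenerated → IsNilpotent →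
    (K : ℕ) → 1 ≤ K → (A : List (Group.Carrier G)) → IsApproxSubgroup K A →
    GeneratedByCentre A →
    Σ ℕ λ r → Σ (ℕ → Pred (Group.Carrier G) (c ⊔ ℓ)) λ Γ → GoodCentralSeries A r Γ
lemma4p4 G _ (n , γₙ-trivial) _ _ A approx G=AZ = r , Γ , record
  { normal     = λ { zero () ; (suc i) _ _ → Δ-normal (proj₁ (pos i)) (proj₂ (pos i)) }
  ; first⊆     = Δ⊆γ 0 A
  ; first⊇     = γ⊆ΔA 0
  ; last⊆      = λ x∈ → γₙ-trivial (γ-decreasing n (Δ⊆γ n A (P.subst (λ s → ΔS s _) pos-r x∈)))
  ; last⊇      = λ x∈ → P.subst (λ s → ΔS s _) (P.sym pos-r) (Trivial⊆ (⟨⟩-isSubgroup _) x∈)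
  ; decreasing = λ { zero () ; (suc i) _ _ → next-⊆ (pos i) }
  ; central    = λ { zero () ; (suc i) _ _ → next-central (pos i) }
  ; approx     = λ { zero () ; (suc i) _ _ → next-approx (pos i) (pos-⊆A i) }
  }
  where
  open Group G using (Carrier)
  open GroupDefs G
  open GroupTheory G
  open Series A
  open IsApproxSubgroup approx using (symmetric; has-ε)
  open Approximation symmetric has-ε G=AZ

  r : ℕ
  r = proj₁ (reach n)
  pos-r : pos r ≡ (n , A)
  pos-r = proj₂ (reach n)

  Γ : ℕ → Pred Carrier L
  Γ zero = Whole
  Γ (suc i) = ΔS (pos i)
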